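{- Let $f:\mathbb N\to\mathbb N$ and $\kappa:\mathbb N\to\mathbb N$ be defined by $$f(n)=\begin{cases}\lfloor\varphi n\rfloor+1,& n\in R_{0,0},\\ \lfloor(\varphi-1)n\rfloor,& n\in R_{1,0},\end{cases}\qquad \kappa(n)=\begin{cases}\lfloor\varphi n+1\rfloor,& n\in R_{2,0},\\ \lfloor\varphi n-1\rfloor,& n\in R_{1,0},\\ \lfloor(\varphi-1)n+1\rfloor,& n\in R_{1,1}.\end{cases}$$ (Both are permutations of $\mathbb N$.) Then $f\circ\kappa=\kappa^{ -1}\circ f$.
   Context: Let $\varphi=\frac{1+\sqrt5}{2}$ and $\mathbb N=\{1,2,3,\dots\}$; $a(n)=\lfloor n\varphi\rfloor$. $F$ is the Fibonacci sequence, $F(0)=0$, $F(1)=F(2)=1$, $F(n)=F(n-1)+F(n-2)$. For $i\in\mathbb Z^{\geq0}$, $j\in\mathbb Z$, let $f_{i,j}(n)=F(i+1)a(n)+F(i)n-j$ ($n\in\mathbb N$) and $R_{i,j}=\{f_{i,j}(n)\mid n\in\mathbb N\}$. The sets $R_{0,0},R_{1,0}$ partition $\mathbb N$, and so do $R_{1,0},R_{1,1},R_{2,0}$. -}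

module Defs where

open import Data.Nat using (ℕ; zero; suc; _+_; _*_; _∸_; _^_; _≤_; _≤ᵇ_)
open import Data.Bool using (if_then_else_)
open import Data.Product using (∃-syntax; _×_)
open import Relation.Binary.PropositionalEquality using (_≡_)

F : ℕ → ℕ
F zero = 0
F (suc zero) = 1
F (suc (suc n)) = F (suc n) + F n

-- For n, m ∈ ℕ:  m ≤ n·φ  ⇔  2m − n ≤ n·√5  ⇔  (2m ∸ n)² ≤ 5 n²
-- (if 2m ≤ n both sides hold trivially; otherwise square the nonnegative sides).
-- This predicate is downward closed in m.
leφ : ℕ → ℕ → Set
leφ m n = (2 * m ∸ n) ^ 2 ≤ 5 * n ^ 2

count : ℕ → ℕ → ℕ
count zero n = 0
count (suc k) n = (if ((2 * suc k ∸ n) ^ 2 ≤ᵇ 5 * n ^ 2) then 1 else 0) + count k n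

-- a n = ⌊ n φ ⌋ : since n·φ < 2n, ⌊nφ⌋ = #{ m ∈ {1,…,2n} | m ≤ nφ }.
a : ℕ → ℕ
a n = count (2 * n) n

-- Membership in R_{i,j} = { F(i+1) a(m) + F(i) m − j | m ∈ ℕ, m ≥ 1 }
-- (only needed for j ≥ 0, so j : ℕ and the equation is written additively).
InR : ℕ → ℕ → ℕ → Set
InR i j n = ∃[ m ] (1 ≤ m × F (suc i) * a m + F i * m ≡ n + j)

-- On naturals, x ≤ φy is the quadratic condition x² ≤ xy + y², and since φ is irrational
-- the form Q(x, y) = x² − xy − y² never vanishes for y ≥ 1. The substitution (x, y) ↦ (x + y, x)
-- changes the sign of Q; this yields, with b m = a m + m, the Beatty identities
-- a (a m) = b m − 1 and a (b m) = b m + a m, and that every n ≥ 1 is a m or b m for some m ≥ 1.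
-- Hence R₀₀, R₁₀, R₁₁, R₂₀ are the images of a, b, a ∘ a, a ∘ b; f exchanges a j and b j, and κ maps
-- a (a m) ↦ a m, b m ↦ b (a m), a (b m) ↦ b (b m), so κ ∘ f ∘ κ = f on each of the three classes.
module Submission where

open import Defs
open import Data.Bool using (true; false; T)
open import Data.Empty using (⊥-elim)
open import Data.Nat
open import Data.Nat.Induction using (<-rec)
open import Data.Nat.Properties
open import Data.Nat.Tactic.RingSolver using (solve-∀)
open import Data.Product using (_×_; _,_; proj₁)
open import Data.Sum using (_⊎_; inj₁; inj₂)
open import Data.Unit using (tt)
open import Function using (_∘_)
open import Relation.Nullary using (¬_; yes; no)
open import Relation.Nullary.Decidable using (map′)
open import Relation.Binary.Definitions using (Decidable)
open import Relation.Binary.PropositionalEquality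
open ≡-Reasoning

infix 4 _≤φ*_ _>φ*_ _≤φ*?_

-- x ≤φ* y stands for x ≤ φ y. Records rather than plain definitions, so that x and y can be
-- inferred from a proof's type.
record _≤φ*_ (x y : ℕ) : Set where
  constructor ≤φ*-intro
  field ≤φ*-elim : x * x ≤ x * y + y * y
open _≤φ*_

record _>φ*_ (x y : ℕ) : Set where
  constructor >φ*-intro
  field >φ*-elim : x * y + y * y < x * x

_≤φ*?_ : Decidable _≤φ*_
x ≤φ*? y = map′ ≤φ*-intro ≤φ*-elim (x * x ≤? x * y + y * y)

>φ*⇒≰φ* : ∀ {x y} → x >φ* y → ¬ x ≤φ* y
>φ*⇒≰φ* (>φ*-intro g) (≤φ*-intro l) = <⇒≱ g l

≰φ*⇒>φ* : ∀ {x y} → ¬ x ≤φ* y → x >φ* y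
≰φ*⇒>φ* ¬l = >φ*-intro (≰⇒> (¬l ∘ ≤φ*-intro))

≯φ*⇒≤φ* : ∀ {x y} → ¬ x >φ* y → x ≤φ* y
≯φ*⇒≤φ* ¬g = ≤φ*-intro (≮⇒≥ (¬g ∘ >φ*-intro))

b : ℕ → ℕ
b m = a m + m

≤-cancel-balanced : ∀ {p q r s} → p + s ≡ q + r → r ≤ s → p ≤ q
≤-cancel-balanced {p} {q} {r} {s} eq r≤s =
  +-cancelʳ-≤ s p q (≤-trans (≤-reflexive eq) (+-monoʳ-≤ q r≤s))

<-cancel-balanced : ∀ {p q r s} → p + s ≡ q + r → r < s → p < q
<-cancel-balanced {q = q} {r} eq r<s =
  ≤-cancel-balanced (trans (cong suc eq) (sym (+-suc q r))) r<s

-- Q(x + y, x) = − Q(x, y), with both sides moved so that no subtraction occurs.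
Q-flip : ∀ x y → (x + y) * (x + y) + x * x ≡ ((x + y) * x + x * x) + (x * y + y * y)
Q-flip = solve-∀

-- Q(2x + y, x + y) = Q(x, y), likewise.
Q-step : ∀ x y → ((x + y) + x) * ((x + y) + x) + (x * y + y * y)
               ≡ (((x + y) + x) * (x + y) + (x + y) * (x + y)) + x * x
Q-step = solve-∀

≤⇒square< : ∀ {x y} → 1 ≤ y → x ≤ y → x * x < x * y + y * y
≤⇒square< {x} {y} 1≤y x≤y =
  <-≤-trans (s≤s (*-monoʳ-≤ x x≤y)) (m<m+n (x * y) (*-mono-≤ 1≤y 1≤y))

≤⇒≤φ* : ∀ {x y} → x ≤ y → x ≤φ* y
≤⇒≤φ* {x} {y} x≤y = ≤φ*-intro (≤-trans (*-monoʳ-≤ x x≤y) (m≤m+n (x * y) (y * y)))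

-- Descent: x² = xy + y² with x = y + z forces y² = yz + z² with 1 ≤ z < y.
φ-irrational : ∀ {x y} → 1 ≤ y → x * x ≢ x * y + y * y
φ-irrational {x} {y} = <-rec (λ y → ∀ x → 1 ≤ y → x * x ≢ x * y + y * y) descend y x
  where
  descend : ∀ y → (∀ {z} → z < y → ∀ x → 1 ≤ z → x * x ≢ x * z + z * z)
          → ∀ x → 1 ≤ y → x * x ≢ x * y + y * y
  descend y rec x 1≤y eq with x ≤? y
  ... | yes x≤y = <⇒≢ (≤⇒square< 1≤y x≤y) eq
  ... | no x≰y with m≤n⇒∃[o]m+o≡n (<⇒≤ (≰⇒> x≰y))
  ...   | zero , refl = x≰y (≤-reflexive (+-identityʳ y))
  ...   | suc z , refl = rec z<y y (s≤s z≤n) smaller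
    where
    smaller : y * y ≡ y * suc z + suc z * suc z
    smaller = +-cancelˡ-≡ ((y + suc z) * y + y * y) _ _
      (trans (sym (cong (_+ y * y) eq)) (Q-flip y (suc z)))
    z<y : suc z < y
    z<y = ≰⇒> (λ y≤z → <⇒≢ (≤⇒square< (s≤s z≤n) y≤z) smaller)

>φ*⇒+≤φ* : ∀ {x y} → x >φ* y → x + y ≤φ* x
>φ*⇒+≤φ* {x} {y} (>φ*-intro g) = ≤φ*-intro (≤-cancel-balanced (Q-flip x y) (<⇒≤ g))

≤φ*⇒+>φ* : ∀ {x y} → 1 ≤ y → x ≤φ* y → x + y >φ* x
≤φ*⇒+>φ* {x} {y} 1≤y (≤φ*-intro l) =
  >φ*-intro (<-cancel-balanced (sym (Q-flip x y)) (≤∧≢⇒< l (φ-irrational {x} 1≤y)))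

+>φ*⇒≤φ* : ∀ {x y} → x + y >φ* x → x ≤φ* y
+>φ*⇒≤φ* g = ≯φ*⇒≤φ* (>φ*⇒≰φ* g ∘ >φ*⇒+≤φ*)

≤φ*-step : ∀ {x y} → x ≤φ* y → (x + y) + x ≤φ* x + y
≤φ*-step {x} {y} (≤φ*-intro l) = ≤φ*-intro (≤-cancel-balanced (Q-step x y) l)

>φ*-step : ∀ {x y} → x >φ* y → (x + y) + x >φ* x + y
>φ*-step {x} {y} (>φ*-intro g) = >φ*-intro (<-cancel-balanced (sym (Q-step x y)) g)

≤φ*-step⁻¹ : ∀ {x y} → (x + y) + x ≤φ* x + y → x ≤φ* y
≤φ*-step⁻¹ l = ≯φ*⇒≤φ* (λ g → >φ*⇒≰φ* (>φ*-step g) l)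

>φ*-step⁻¹ : ∀ {x y} → (x + y) + x >φ* x + y → x >φ* y
>φ*-step⁻¹ g = ≰φ*⇒>φ* (>φ*⇒≰φ* g ∘ ≤φ*-step)

suc-2*>φ* : ∀ y → suc (2 * y) >φ* y
suc-2*>φ* y = >φ*-intro (subst (suc (suc (2 * y) * y + y * y) ≤_) (sym (square y)) (m≤m+n _ _))
  where
  square : ∀ y → suc (2 * y) * suc (2 * y) ≡ suc (suc (2 * y) * y + y * y) + (y * y + 3 * y)
  square = solve-∀

-- The solver does not accept _^_, so t ^ 2 appears unfolded as t * (t * 1).
private
  4m²-expand : ∀ m → 4 * (m * m) ≡ (2 * m) * (2 * m)
  4m²-expand = solve-∀

  4[mn+n²]-expand : ∀ m n → 4 * (m * n + n * n) ≡ 2 * (2 * m) * n + 4 * (n * n)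
  4[mn+n²]-expand = solve-∀

  [t+n]²-expand : ∀ t n → (t + n) * (t + n) ≡ t * (t * 1) + (2 * t * n + n * n)
  [t+n]²-expand = solve-∀

  2[t+n]n+4n²-expand : ∀ t n → 2 * (t + n) * n + 4 * (n * n) ≡ 5 * (n * (n * 1)) + (2 * t * n + n * n)
  2[t+n]n+4n²-expand = solve-∀

-- Squaring (2m − n) ≤ n√5 turns it into 4m² ≤ 4(mn + n²); with 2m = t + n both sides
-- differ from t² ≤ 5n² by the same summand 2tn + n².
module _ {m n t : ℕ} (2m≡t+n : 2 * m ≡ t + n) where

  private
    4m² : 4 * (m * m) ≡ t ^ 2 + (2 * t * n + n * n)
    4m² = begin
      4 * (m * m)                 ≡⟨ 4m²-expand m ⟩
      (2 * m) * (2 * m)           ≡⟨ cong (λ z → z * z) 2m≡t+n ⟩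
      (t + n) * (t + n)           ≡⟨ [t+n]²-expand t n ⟩
      t ^ 2 + (2 * t * n + n * n) ∎

    4[mn+n²] : 4 * (m * n + n * n) ≡ 5 * n ^ 2 + (2 * t * n + n * n)
    4[mn+n²] = begin
      4 * (m * n + n * n)               ≡⟨ 4[mn+n²]-expand m n ⟩
      2 * (2 * m) * n + 4 * (n * n)     ≡⟨ cong (λ z → 2 * z * n + 4 * (n * n)) 2m≡t+n ⟩
      2 * (t + n) * n + 4 * (n * n)     ≡⟨ 2[t+n]n+4n²-expand t n ⟩
      5 * n ^ 2 + (2 * t * n + n * n)   ∎

  square≤⇒≤φ* : t ^ 2 ≤ 5 * n ^ 2 → m ≤φ* n
  square≤⇒≤φ* h = ≤φ*-intro (*-cancelˡ-≤ 4
    (subst₂ _≤_ (sym 4m²) (sym 4[mn+n²]) (+-monoˡ-≤ (2 * t * n + n * n) h)))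

  ≤φ*⇒square≤ : m ≤φ* n → t ^ 2 ≤ 5 * n ^ 2
  ≤φ*⇒square≤ (≤φ*-intro l) = +-cancelʳ-≤ (2 * t * n + n * n) _ _
    (subst₂ _≤_ 4m² 4[mn+n²] (*-monoʳ-≤ 4 l))

leφ⇒≤φ* : ∀ m n → leφ m n → m ≤φ* n
leφ⇒≤φ* m n l with 2 * m ≤? n
... | yes 2m≤n = ≤⇒≤φ* (≤-trans (m≤m+n m (m + 0)) 2m≤n)
... | no 2m≰n = square≤⇒≤φ* (sym (m∸n+n≡m (<⇒≤ (≰⇒> 2m≰n)))) l

≤φ*⇒leφ : ∀ m n → m ≤φ* n → leφ m n
≤φ*⇒leφ m n l with 2 * m ≤? n
... | yes 2m≤n rewrite m≤n⇒m∸n≡0 2m≤n = z≤n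
... | no 2m≰n = ≤φ*⇒square≤ (sym (m∸n+n≡m (<⇒≤ (≰⇒> 2m≰n)))) l

leφ-antitone : ∀ {i j} n → i ≤ j → leφ j n → leφ i n
leφ-antitone n i≤j = ≤-trans (^-monoˡ-≤ 2 (∸-monoˡ-≤ n (*-monoʳ-≤ 2 i≤j)))

≤φ*-antitone : ∀ {i j n} → i ≤ j → j ≤φ* n → i ≤φ* n
≤φ*-antitone {i} {j} {n} i≤j l = leφ⇒≤φ* i n (leφ-antitone n i≤j (≤φ*⇒leφ j n l))

count-full : ∀ k n → leφ k n → count k n ≡ k
count-full zero n _ = refl
count-full (suc k) n l with (2 * suc k ∸ n) ^ 2 ≤ᵇ 5 * n ^ 2 in test
... | true = cong suc (count-full k n (leφ-antitone n (n≤1+n k) l))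
... | false = ⊥-elim (subst T test (≤⇒≤ᵇ l))

-- Since leφ · n is downward closed, count k n is the largest c ≤ k with leφ c n.
count-max : ∀ k n → leφ (count k n) n × (count k n ≡ k ⊎ ¬ leφ (suc (count k n)) n)
count-max zero n = ≤φ*⇒leφ 0 n (≤⇒≤φ* z≤n) , inj₁ refl
count-max (suc k) n with (2 * suc k ∸ n) ^ 2 ≤ᵇ 5 * n ^ 2 in test
... | false with count-max k n
...   | l , inj₂ ¬l′ = l , inj₂ ¬l′
...   | l , inj₁ full rewrite full = l , inj₂ (λ l′ → subst T test (≤⇒≤ᵇ l′))
count-max (suc k) n | true with ≤ᵇ⇒≤ _ _ (subst T (sym test) tt)
...   | holds rewrite count-full k n (leφ-antitone n (n≤1+n k) holds) = holds , inj₁ refl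

a-≤φ* : ∀ n → a n ≤φ* n
a-≤φ* n = leφ⇒≤φ* (a n) n (proj₁ (count-max (2 * n) n))

suc-a->φ* : ∀ n → suc (a n) >φ* n
suc-a->φ* n with count-max (2 * n) n
... | _ , inj₁ full rewrite full = suc-2*>φ* n
... | _ , inj₂ ¬l = ≰φ*⇒>φ* (¬l ∘ ≤φ*⇒leφ (suc (a n)) n)

≤φ*⇒≤a : ∀ {j n} → j ≤φ* n → j ≤ a n
≤φ*⇒≤a {n = n} l = ≮⇒≥ (λ a<j → >φ*⇒≰φ* (suc-a->φ* n) (≤φ*-antitone a<j l))

>φ*⇒a< : ∀ {j n} → j >φ* n → a n < j
>φ*⇒a< {n = n} g = ≰⇒> (λ j≤a → >φ*⇒≰φ* g (≤φ*-antitone j≤a (a-≤φ* n)))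

a-unique : ∀ {j n} → j ≤φ* n → suc j >φ* n → a n ≡ j
a-unique l g = ≤-antisym (≤-pred (>φ*⇒a< g)) (≤φ*⇒≤a l)

n≤a : ∀ n → n ≤ a n
n≤a n = ≤φ*⇒≤a (≤⇒≤φ* ≤-refl)

a-pos : ∀ {m} → 1 ≤ m → 1 ≤ a m
a-pos {m} 1≤m = ≤-trans 1≤m (n≤a m)

b-pos : ∀ {m} → 1 ≤ m → 1 ≤ b m
b-pos {m} 1≤m = ≤-trans 1≤m (m≤n+m m (a m))

b-pos⁻¹ : ∀ {m} → 1 ≤ b m → 1 ≤ m
b-pos⁻¹ {zero} ()
b-pos⁻¹ {suc m} _ = s≤s z≤n

≤φ*⇒≤2* : ∀ {x y} → x ≤φ* y → x ≤ 2 * y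
≤φ*⇒≤2* {y = y} l = ≮⇒≥ (λ 2y<x → >φ*⇒≰φ* (suc-2*>φ* y) (≤φ*-antitone 2y<x l))

≤φ*-suc : ∀ {x y} → x ≤φ* y → suc x ≤φ* suc y
≤φ*-suc {x} {y} l = ≤φ*-intro (≤-cancel-balanced (expand x y) (+-mono-≤ (≤φ*-elim l) x≤3y+1))
  where
  expand : ∀ x y → suc x * suc x + ((x * y + y * y) + (3 * y + 1))
                 ≡ (suc x * suc y + suc y * suc y) + (x * x + x)
  expand = solve-∀
  x≤3y+1 : x ≤ 3 * y + 1
  x≤3y+1 = ≤-trans (≤φ*⇒≤2* l) (≤-trans (*-monoˡ-≤ y (n≤1+n 2)) (m≤m+n (3 * y) 1))

>φ*-pred : ∀ {x y} → suc x >φ* suc y → x >φ* y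
>φ*-pred g = ≰φ*⇒>φ* (>φ*⇒≰φ* g ∘ ≤φ*-suc)

suc-a∘a≡b : ∀ {m} → 1 ≤ m → suc (a (a m)) ≡ b m
suc-a∘a≡b {suc m} _ = begin
  suc (a k)     ≡⟨ cong suc (a-unique below above) ⟩
  suc (k + m)   ≡⟨ +-suc k m ⟨
  b (suc m)     ∎
  where
  k : ℕ
  k = a (suc m)
  below : k + m ≤φ* k
  below = >φ*⇒+≤φ* (>φ*-pred (suc-a->φ* (suc m)))
  above : suc (k + m) >φ* k
  above = subst (_>φ* k) (+-suc k m) (≤φ*⇒+>φ* (s≤s z≤n) (a-≤φ* (suc m)))

a∘b≡b+a : ∀ m → a (b m) ≡ b m + a m
a∘b≡b+a m = a-unique (≤φ*-step (a-≤φ* m)) above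
  where
  above : suc (b m + a m) >φ* b m
  above = >φ*-pred (subst (_>φ* suc (b m)) (+-suc (suc (b m)) (a m)) (>φ*-step (suc-a->φ* m)))

data Wythoff : ℕ → Set where
  lower : ∀ {m} → 1 ≤ m → Wythoff (a m)
  upper : ∀ {m} → 1 ≤ m → Wythoff (b m)

-- With a n = n + q, either a (q + 1) = n, or n = q + r with a r = q.
wythoff-split : ∀ {n q} → n + q ≤φ* n → suc (n + q) >φ* n → q ≤ n → 1 ≤ n → Wythoff n
wythoff-split {n} {q} below above q≤n 1≤n with suc n ≤φ*? suc q
... | no n+1>φq+1 = subst Wythoff (a-unique n≤φq+1 (≰φ*⇒>φ* n+1>φq+1)) (lower {suc q} (s≤s z≤n))
  where
  n≤φq+1 : n ≤φ* suc q
  n≤φq+1 = +>φ*⇒≤φ* (subst (_>φ* n) (sym (+-suc n q)) above)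
... | yes n+1≤φq+1 with m≤n⇒∃[o]m+o≡n q≤n
...   | r , refl = subst (λ x → Wythoff (x + r)) aᵣ≡q (upper (b-pos⁻¹ {r} 1≤bᵣ))
  where
  aᵣ≡q : a r ≡ q
  aᵣ≡q = a-unique (≤φ*-step⁻¹ below) (>φ*-step⁻¹ (≤φ*⇒+>φ* (s≤s z≤n) n+1≤φq+1))
  1≤bᵣ : 1 ≤ b r
  1≤bᵣ = subst (λ x → 1 ≤ x + r) (sym aᵣ≡q) 1≤n

wythoff : ∀ {n} → 1 ≤ n → Wythoff n
wythoff {n} 1≤n with m≤n⇒∃[o]m+o≡n (n≤a n)
... | q , n+q≡a = wythoff-split below above q≤n 1≤n
  where
  below : n + q ≤φ* n
  below = subst (_≤φ* n) (sym n+q≡a) (a-≤φ* n)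
  above : suc (n + q) >φ* n
  above = subst (λ x → suc x >φ* n) (sym n+q≡a) (suc-a->φ* n)
  q≤n : q ≤ n
  q≤n = +-cancelˡ-≤ n q n (≤-trans (≤-reflexive n+q≡a) (≤-trans (≤φ*⇒≤2* (a-≤φ* n)) 2n≤n+n))
    where
    2n≤n+n : 2 * n ≤ n + n
    2n≤n+n = ≤-reflexive (cong (n +_) (+-identityʳ n))

data Wythoff² : ℕ → Set where
  lower-lower : ∀ {m} → 1 ≤ m → Wythoff² (a (a m))
  lower-upper : ∀ {m} → 1 ≤ m → Wythoff² (a (b m))
  upper       : ∀ {m} → 1 ≤ m → Wythoff² (b m)

refine : ∀ {n} → Wythoff n → Wythoff² n
refine (upper 1≤m) = upper 1≤m
refine (lower 1≤j) with wythoff 1≤j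
... | lower 1≤m = lower-lower 1≤m
... | upper 1≤m = lower-upper 1≤m

a∈R₀₀ : ∀ {m} → 1 ≤ m → InR 0 0 (a m)
a∈R₀₀ {m} 1≤m = m , 1≤m , cong₂ _+_ (*-identityˡ (a m)) (*-zeroˡ m)

b∈R₁₀ : ∀ {m} → 1 ≤ m → InR 1 0 (b m)
b∈R₁₀ {m} 1≤m = m , 1≤m , trans (cong₂ _+_ (*-identityˡ (a m)) (*-identityˡ m)) (sym (+-identityʳ (b m)))

a∘a∈R₁₁ : ∀ {m} → 1 ≤ m → InR 1 1 (a (a m))
a∘a∈R₁₁ {m} 1≤m = m , 1≤m , (begin
  1 * a m + 1 * m  ≡⟨ cong₂ _+_ (*-identityˡ (a m)) (*-identityˡ m) ⟩
  b m              ≡⟨ suc-a∘a≡b 1≤m ⟨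
  suc (a (a m))    ≡⟨ +-comm 1 (a (a m)) ⟩
  a (a m) + 1      ∎)

a∘b∈R₂₀ : ∀ {m} → 1 ≤ m → InR 2 0 (a (b m))
a∘b∈R₂₀ {m} 1≤m = m , 1≤m , trans (normalise (a m) m) (cong (_+ 0) (sym (a∘b≡b+a m)))
  where
  normalise : ∀ x y → 2 * x + 1 * y ≡ ((x + y) + x) + 0
  normalise = solve-∀

module Conjugacy {f κ : ℕ → ℕ}
  (f-R₀₀ : ∀ n → InR 0 0 n → f n ≡ a n + 1)
  (f-R₁₀ : ∀ n → InR 1 0 n → f n ≡ a n ∸ n)
  (κ-R₂₀ : ∀ n → InR 2 0 n → κ n ≡ a n + 1)
  (κ-R₁₀ : ∀ n → InR 1 0 n → κ n ≡ a n ∸ 1)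
  (κ-R₁₁ : ∀ n → InR 1 1 n → κ n ≡ (a n ∸ n) + 1) where

  f-a : ∀ {j} → 1 ≤ j → f (a j) ≡ b j
  f-a {j} 1≤j = begin
    f (a j)        ≡⟨ f-R₀₀ _ (a∈R₀₀ 1≤j) ⟩
    a (a j) + 1    ≡⟨ +-comm (a (a j)) 1 ⟩
    suc (a (a j))  ≡⟨ suc-a∘a≡b 1≤j ⟩
    b j            ∎

  f-b : ∀ {j} → 1 ≤ j → f (b j) ≡ a j
  f-b {j} 1≤j = begin
    f (b j)            ≡⟨ f-R₁₀ _ (b∈R₁₀ 1≤j) ⟩
    a (b j) ∸ b j      ≡⟨ cong (_∸ b j) (a∘b≡b+a j) ⟩
    (b j + a j) ∸ b j  ≡⟨ m+n∸m≡n (b j) (a j) ⟩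
    a j                ∎

  κ-a∘a : ∀ {m} → 1 ≤ m → κ (a (a m)) ≡ a m
  κ-a∘a {m} 1≤m = begin
    κ N              ≡⟨ κ-R₁₁ _ (a∘a∈R₁₁ 1≤m) ⟩
    (a N ∸ N) + 1    ≡⟨ +-∸-comm 1 (n≤a N) ⟨
    (a N + 1) ∸ N    ≡⟨ cong (_∸ N) (+-comm (a N) 1) ⟩
    suc (a N) ∸ N    ≡⟨ cong (_∸ N) (suc-a∘a≡b (a-pos 1≤m)) ⟩
    (N + a m) ∸ N    ≡⟨ m+n∸m≡n N (a m) ⟩
    a m              ∎
    where
    N : ℕ
    N = a (a m)

  κ-a∘b : ∀ {m} → 1 ≤ m → κ (a (b m)) ≡ b (b m)
  κ-a∘b {m} 1≤m = begin
    κ (a (b m))        ≡⟨ κ-R₂₀ _ (a∘b∈R₂₀ 1≤m) ⟩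
    a (a (b m)) + 1    ≡⟨ +-comm (a (a (b m))) 1 ⟩
    suc (a (a (b m)))  ≡⟨ suc-a∘a≡b (b-pos 1≤m) ⟩
    b (b m)            ∎

  κ-b : ∀ {m} → 1 ≤ m → κ (b m) ≡ b (a m)
  κ-b {m} 1≤m = begin
    κ (b m)                    ≡⟨ κ-R₁₀ _ (b∈R₁₀ 1≤m) ⟩
    a (b m) ∸ 1                ≡⟨ cong (_∸ 1) (a∘b≡b+a m) ⟩
    (b m + a m) ∸ 1            ≡⟨ cong (λ x → (x + a m) ∸ 1) (suc-a∘a≡b 1≤m) ⟨
    (suc (a (a m)) + a m) ∸ 1  ≡⟨⟩
    b (a m)                    ∎

  κ∘f∘κ : ∀ {n} → Wythoff² n → κ (f (κ n)) ≡ f n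
  κ∘f∘κ (lower-lower {m} 1≤m) = begin
    κ (f (κ (a (a m))))  ≡⟨ cong (κ ∘ f) (κ-a∘a 1≤m) ⟩
    κ (f (a m))          ≡⟨ cong κ (f-a 1≤m) ⟩
    κ (b m)              ≡⟨ κ-b 1≤m ⟩
    b (a m)              ≡⟨ f-a (a-pos 1≤m) ⟨
    f (a (a m))          ∎
  κ∘f∘κ (lower-upper {m} 1≤m) = begin
    κ (f (κ (a (b m))))  ≡⟨ cong (κ ∘ f) (κ-a∘b 1≤m) ⟩
    κ (f (b (b m)))      ≡⟨ cong κ (f-b (b-pos 1≤m)) ⟩
    κ (a (b m))          ≡⟨ κ-a∘b 1≤m ⟩
    b (b m)              ≡⟨ f-a (b-pos 1≤m) ⟨
    f (a (b m))          ∎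
  κ∘f∘κ (upper {m} 1≤m) = begin
    κ (f (κ (b m)))      ≡⟨ cong (κ ∘ f) (κ-b 1≤m) ⟩
    κ (f (b (a m)))      ≡⟨ cong κ (f-b (a-pos 1≤m)) ⟩
    κ (a (a m))          ≡⟨ κ-a∘a 1≤m ⟩
    a m                  ≡⟨ f-b 1≤m ⟨
    f (b m)              ∎

  f∘κ-pos : ∀ {n} → Wythoff² n → 1 ≤ f (κ n)
  f∘κ-pos (lower-lower 1≤m) =
    subst (1 ≤_) (sym (trans (cong f (κ-a∘a 1≤m)) (f-a 1≤m))) (b-pos 1≤m)
  f∘κ-pos (lower-upper 1≤m) =
    subst (1 ≤_) (sym (trans (cong f (κ-a∘b 1≤m)) (f-b (b-pos 1≤m)))) (a-pos (b-pos 1≤m))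
  f∘κ-pos (upper 1≤m) =
    subst (1 ≤_) (sym (trans (cong f (κ-b 1≤m)) (f-b (a-pos 1≤m)))) (a-pos (a-pos 1≤m))

theorem4p8 : (f κ κ⁻¹ : ℕ → ℕ)
    → (∀ n → InR 0 0 n → f n ≡ a n + 1)
    → (∀ n → InR 1 0 n → f n ≡ a n ∸ n)
    → (∀ n → InR 2 0 n → κ n ≡ a n + 1)
    → (∀ n → InR 1 0 n → κ n ≡ a n ∸ 1)
    → (∀ n → InR 1 1 n → κ n ≡ (a n ∸ n) + 1)
    → (∀ n → 1 ≤ n → κ⁻¹ (κ n) ≡ n)
    → (∀ n → 1 ≤ n → κ (κ⁻¹ n) ≡ n)
    → ∀ n → 1 ≤ n → f (κ n) ≡ κ⁻¹ (f n)
theorem4p8 f κ κ⁻¹ f-R₀₀ f-R₁₀ κ-R₂₀ κ-R₁₀ κ-R₁₁ κ⁻¹∘κ _ n 1≤n = begin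
  f (κ n)            ≡⟨ κ⁻¹∘κ (f (κ n)) (f∘κ-pos classes) ⟨
  κ⁻¹ (κ (f (κ n)))  ≡⟨ cong κ⁻¹ (κ∘f∘κ classes) ⟩
  κ⁻¹ (f n)          ∎
  where
  open Conjugacy f-R₀₀ f-R₁₀ κ-R₂₀ κ-R₁₀ κ-R₁₁
  classes : Wythoff² n
  classes = refine (wythoff 1≤n)
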